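{- Let $r\ge 3$ be an integer and let $G$ be a (possibly infinite) $r$-chordal graph. Then the edge set of every cycle $O$ of $G$ of length $\ell\le r$ is the symmetric difference of the edge sets of $\ell-2$ triangles of $G$ whose vertex sets are contained in $V(O)$.
   Context: A graph is $r$-chordal if every cycle of length at least $4$ and at most $r$ has a chord. A triangle is a cycle of length $3$. -}

module Defs where

open import Level using (0ℓ)
open import Data.Nat using (ℕ; zero; suc; _≤_; _<_; _∸_)
open import Data.Fin using (Fin; toℕ)
import Data.Fin as F
open import Data.Product using (Σ; ∃; ∃-syntax; _×_; _,_)
open import Data.Sum using (_⊎_)
open import Data.Empty using (⊥)
open import Data.List using (List; []; _∷_; foldr; map; length)
open import Data.List.Relation.Unary.Unique.Propositional using (Unique)
open import Relation.Nullary using (¬_)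
open import Relation.Binary.PropositionalEquality using (_≡_; _≢_)
open import Function.Bundles using (_⇔_)
open import Function.Definitions using (Injective)

record Graph : Set₁ where
  field
    V     : Set
    E     : V → V → Set
    sym   : ∀ {x y} → E x y → E y x
    irrfl : ∀ {x} → ¬ E x x

module _ (G : Graph) where
  open Graph G

  CycNext : {ℓ : ℕ} → Fin ℓ → Fin ℓ → Set
  CycNext {ℓ} i j = (suc (toℕ i) ≡ toℕ j) ⊎ (suc (toℕ i) ≡ ℓ × toℕ j ≡ 0)

  Consec : {ℓ : ℕ} → Fin ℓ → Fin ℓ → Set
  Consec i j = CycNext i j ⊎ CycNext j i

  IsCycle : (ℓ : ℕ) → (Fin ℓ → V) → Set
  IsCycle ℓ v = (3 ≤ ℓ) × Injective _≡_ _≡_ v × (∀ i j → CycNext i j → E (v i) (v j))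

  HasChord : (ℓ : ℕ) → (Fin ℓ → V) → Set
  HasChord ℓ v = ∃[ i ] ∃[ j ] (E (v i) (v j) × ¬ Consec i j × i ≢ j)

  Chordal : ℕ → Set
  Chordal r = ∀ (ℓ : ℕ) (v : Fin ℓ → V) → IsCycle ℓ v → 4 ≤ ℓ → ℓ ≤ r → HasChord ℓ v

  -- edge sets as predicates on (ordered representations of) unordered pairs
  EdgeSet : Set₁
  EdgeSet = V → V → Set

  UEq : V → V → V → V → Set
  UEq x y a b = (x ≡ a × y ≡ b) ⊎ (x ≡ b × y ≡ a)

  cycleEdges : {ℓ : ℕ} → (Fin ℓ → V) → EdgeSet
  cycleEdges {ℓ} v x y = ∃[ i ] ∃[ j ] (CycNext i j × UEq x y (v i) (v j))

  _Δ_ : EdgeSet → EdgeSet → EdgeSet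
  (P Δ Q) x y = (P x y × ¬ Q x y) ⊎ (¬ P x y × Q x y)

  ∅ : EdgeSet
  ∅ x y = ⊥

  ΔList : List EdgeSet → EdgeSet
  ΔList = foldr _Δ_ ∅

  -- a triangle of G whose vertex set {v i , v j , v k} is contained in V(O),
  -- given by cycle indices i < j < k (canonical, so the vertex set
  -- determines the triple)
  record Tri {ℓ : ℕ} (v : Fin ℓ → V) : Set where
    constructor tri
    field
      i j k : Fin ℓ
      i<j   : i F.< j
      j<k   : j F.< k
      eij   : E (v i) (v j)
      eik   : E (v i) (v k)
      ejk   : E (v j) (v k)

  triIdx : {ℓ : ℕ} {v : Fin ℓ → V} → Tri v → Fin ℓ × Fin ℓ × Fin ℓ
  triIdx t = Tri.i t , Tri.j t , Tri.k t

  triEdges : {ℓ : ℕ} {v : Fin ℓ → V} → Tri v → EdgeSet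
  triEdges {v = v} t x y =
    UEq x y (v (Tri.i t)) (v (Tri.j t)) ⊎ UEq x y (v (Tri.i t)) (v (Tri.k t))
      ⊎ UEq x y (v (Tri.j t)) (v (Tri.k t))

  SameEdges : EdgeSet → EdgeSet → Set
  SameEdges P Q = ∀ x y → P x y ⇔ Q x y

-- For ℓ ≥ 4 the cycle has an ear: three
-- consecutive vertices a, b, c with a adjacent to c. Removing b leaves a cycle of length ℓ − 1
-- whose edge set differs from that of O exactly by the edges of the triangle abc; its
-- triangles avoid b, so abc is new.
-- An ear is found by descent, starting from the closing edge O₀ O_{ℓ−1}: an edge O_i O_j with
-- j − i = m ≥ 3 closes the cycle O_i … O_j of length m + 1 ≤ r, and a chord of that cycle is
-- an edge of the same kind with a smaller gap.
module Submission where

open import Defs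
open import Data.Nat using (ℕ; suc; _≤_; _<_; _∸_; _+_; z≤n; s≤s)
import Data.Nat as ℕ
open import Data.Nat.Properties
  using (suc-injective; ≤-reflexive; ≤-trans; ≤-antisym; <⇒≤; ≤-<-trans; <-≤-trans;
         <-trans; <-irrefl; n≮0; n≮n; n≤0⇒n≡0; n<1+n; n≤1+n; 1+n≢0; 1+n≢n; m≢1+n+m; ≤∧≢⇒<;
         m≤m+n; m<m+n; +-identityʳ; +-assoc; +-monoˡ-≤; +-cancelʳ-≡; +-∸-assoc; m∸n+n≡m)
open import Data.Nat.Induction using (<-wellFounded)
open import Induction.WellFounded using (Acc; acc)
open import Data.Fin using (Fin; toℕ; fromℕ; fromℕ<; punchIn; punchOut)
import Data.Fin as F
open import Data.Fin.Properties
  using (toℕ-injective; toℕ<n; toℕ≤pred[n]; toℕ-fromℕ; toℕ-fromℕ<;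
         punchIn-injective; punchInᵢ≢i; punchIn-mono-≤; punchIn-punchOut)
import Data.Fin.Properties as F
open import Data.Product using (Σ; ∃; ∃-syntax; _×_; _,_; proj₁; proj₂)
import Data.Product as Product
open import Data.Sum using (_⊎_; inj₁; inj₂)
import Data.Sum as Sum
open import Data.Empty using (⊥; ⊥-elim)
open import Data.List using (List; []; _∷_; map; length)
open import Data.List.Properties using (length-map; map-∘)
import Data.List.Relation.Unary.All as All
open All using ([]; _∷_)
open import Data.List.Relation.Unary.AllPairs using ([]; _∷_)
import Data.List.Relation.Unary.All.Properties as All
open import Data.List.Relation.Unary.Unique.Propositional using (Unique)
import Data.List.Relation.Unary.Unique.Propositional.Properties as Unique
open import Relation.Nullary using (¬_; yes; no)
open import Relation.Binary.Definitions using (tri<; tri≈; tri>)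
open import Relation.Binary.PropositionalEquality
  using (_≡_; _≢_; refl; sym; trans; cong; cong₂; subst; subst₂; module ≡-Reasoning)
open import Function using (_∘_)
open import Function.Bundles using (mk⇔; Equivalence)
import Function.Properties.Equivalence as ⇔
open import Function.Definitions using (Injective)

data PunchInView {n} (p : Fin (suc n)) (k : Fin n) : Set where
  below : toℕ k < toℕ p → toℕ (punchIn p k) ≡ toℕ k → PunchInView p k
  above : toℕ p ≤ toℕ k → toℕ (punchIn p k) ≡ suc (toℕ k) → PunchInView p k

punchInView : ∀ {n} (p : Fin (suc n)) (k : Fin n) → PunchInView p k
punchInView F.zero    k         = above z≤n refl
punchInView (F.suc p) F.zero    = below (s≤s z≤n) refl
punchInView (F.suc p) (F.suc k) with punchInView p k
... | below k<p eq = below (s≤s k<p) (cong suc eq)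
... | above p≤k eq = above (s≤s p≤k) (cong suc eq)

punchIn-mono-< : ∀ {n} (p : Fin (suc n)) {k k' : Fin n} → k F.< k' → punchIn p k F.< punchIn p k'
punchIn-mono-< p k<k' =
  F.≤∧≢⇒< (punchIn-mono-≤ p _ _ (<⇒≤ k<k')) (F.<⇒≢ k<k' ∘ punchIn-injective p _ _)

pattern 0F = F.zero
pattern 1F = F.suc F.zero
pattern 2F = F.suc (F.suc F.zero)

module _ (G : Graph) where
  open Graph G using (V; E) renaming (sym to E-sym)

  UEq-swap : ∀ {x y p q} → UEq G x y p q → UEq G x y q p
  UEq-swap = Sum.swap

  UEq-unique : ∀ {x y p q p' q'} → UEq G x y p q → UEq G x y p' q' →
               (p ≡ p' × q ≡ q') ⊎ (p ≡ q' × q ≡ p')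
  UEq-unique (inj₁ (refl , refl)) (inj₁ (refl , refl)) = inj₁ (refl , refl)
  UEq-unique (inj₁ (refl , refl)) (inj₂ (refl , refl)) = inj₂ (refl , refl)
  UEq-unique (inj₂ (refl , refl)) (inj₁ (refl , refl)) = inj₂ (refl , refl)
  UEq-unique (inj₂ (refl , refl)) (inj₂ (refl , refl)) = inj₁ (refl , refl)

  Δ-congʳ : ∀ {R P Q : EdgeSet G} → SameEdges G P Q → SameEdges G (_Δ_ G R P) (_Δ_ G R Q)
  Δ-congʳ P≈Q x y = mk⇔
    (Sum.map (Product.map₂ (_∘ from)) (Product.map₂ to))
    (Sum.map (Product.map₂ (_∘ to)) (Product.map₂ from))
    where open Equivalence (P≈Q x y)

  Δ-identityʳ : ∀ {P : EdgeSet G} → SameEdges G (_Δ_ G P (∅ G)) P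
  Δ-identityʳ x y = mk⇔ (Sum.[ proj₁ , (λ ()) ∘ proj₂ ]) (λ p → inj₁ (p , λ ()))

  CycNext-functional : ∀ {ℓ} {i j j' : Fin ℓ} → CycNext G i j → CycNext G i j' → j ≡ j'
  CycNext-functional (inj₁ e) (inj₁ e') = toℕ-injective (trans (sym e) e')
  CycNext-functional {j = j} (inj₁ e) (inj₂ (e' , _)) = ⊥-elim (<-irrefl (trans (sym e) e') (toℕ<n j))
  CycNext-functional {j' = j'} (inj₂ (e , _)) (inj₁ e') = ⊥-elim (<-irrefl (trans (sym e') e) (toℕ<n j'))
  CycNext-functional (inj₂ (_ , e)) (inj₂ (_ , e')) = toℕ-injective (trans e (sym e'))

  CycNext-injective : ∀ {ℓ} {i i' j : Fin ℓ} → CycNext G i j → CycNext G i' j → i ≡ i'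
  CycNext-injective (inj₁ e) (inj₁ e') = toℕ-injective (suc-injective (trans e (sym e')))
  CycNext-injective (inj₁ e) (inj₂ (_ , e')) = ⊥-elim (1+n≢0 (trans e e'))
  CycNext-injective (inj₂ (_ , e)) (inj₁ e') = ⊥-elim (1+n≢0 (trans e' e))
  CycNext-injective (inj₂ (e , _)) (inj₂ (e' , _)) = toℕ-injective (suc-injective (trans e (sym e')))

  CycNext-serial : ∀ {ℓ} (i : Fin ℓ) → ∃ (CycNext G i)
  CycNext-serial {suc n} i with suc (toℕ i) ℕ.≟ suc n
  ... | yes i+1≡ℓ = 0F , inj₂ (i+1≡ℓ , refl)
  ... | no i+1≢ℓ = fromℕ< i+1<ℓ , inj₁ (sym (toℕ-fromℕ< i+1<ℓ))
    where
    i+1<ℓ : suc (toℕ i) < suc n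
    i+1<ℓ = ≤∧≢⇒< (toℕ<n i) i+1≢ℓ

  punchIn-CycNext⁺ : ∀ {n} (p : Fin (suc n)) {k k' : Fin n} → CycNext G k k' →
                     CycNext G (punchIn p k) (punchIn p k') ⊎
                     (CycNext G (punchIn p k) p × CycNext G p (punchIn p k'))
  punchIn-CycNext⁺ {n} p {k} {k'} = go (punchInView p k) (punchInView p k')
    where
    go : PunchInView p k → PunchInView p k' → CycNext G k k' →
         CycNext G (punchIn p k) (punchIn p k') ⊎
         (CycNext G (punchIn p k) p × CycNext G p (punchIn p k'))
    go (below _ πk) (below _ πk') (inj₁ e) = inj₁ (inj₁ (trans (cong suc πk) (trans e (sym πk'))))
    go (below k<p πk) (above p≤k' πk') (inj₁ e) =
      inj₂ (inj₁ (trans (cong suc πk) (sym p≡k+1)) , inj₁ (trans (cong suc (trans p≡k+1 e)) (sym πk')))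
      where
      p≡k+1 : toℕ p ≡ suc (toℕ k)
      p≡k+1 = ≤-antisym (subst (toℕ p ≤_) (sym e) p≤k') k<p
    go (above p≤k _) (below k'<p _) (inj₁ e) =
      ⊥-elim (n≮n (toℕ k) (<-trans (subst (toℕ k <_) e (n<1+n _)) (<-≤-trans k'<p p≤k)))
    go (above _ πk) (above _ πk') (inj₁ e) =
      inj₁ (inj₁ (trans (cong suc πk) (trans (cong suc e) (sym πk'))))
    go (below k<p πk) (below _ πk') (inj₂ (e , e')) =
      inj₂ (inj₁ (trans (cong suc πk) (trans e (sym p≡n))) , inj₂ (cong suc p≡n , trans πk' e'))
      where
      p≡n : toℕ p ≡ n
      p≡n = ≤-antisym (toℕ≤pred[n] p) (subst (_≤ toℕ p) e k<p)
    go (below k<p _) (above p≤k' _) (inj₂ (_ , e')) =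
      ⊥-elim (n≮0 (≤-trans k<p (subst (toℕ p ≤_) e' p≤k')))
    go (above _ πk) (below _ πk') (inj₂ (e , e')) = inj₁ (inj₂ (cong suc (trans πk e) , trans πk' e'))
    go (above _ πk) (above p≤k' πk') (inj₂ (e , e')) =
      inj₂ (inj₂ (cong suc (trans πk e) , p≡0) ,
            inj₁ (trans (cong suc p≡0) (sym (trans πk' (cong suc e')))))
      where
      p≡0 : toℕ p ≡ 0
      p≡0 = n≤0⇒n≡0 (subst (toℕ p ≤_) e' p≤k')

  punchIn-CycNext⁻ : ∀ {n} (p : Fin (suc n)) {k k' : Fin n} →
                     CycNext G (punchIn p k) (punchIn p k') → CycNext G k k'
  punchIn-CycNext⁻ p {k} {k'} πk→πk' with CycNext-serial k
  ... | k'' , k→k'' with punchIn-CycNext⁺ p k→k''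
  ... | inj₁ πk→πk'' =
    subst (CycNext G k) (punchIn-injective p _ _ (CycNext-functional πk→πk'' πk→πk')) k→k''
  ... | inj₂ (πk→p , _) = ⊥-elim (punchInᵢ≢i p k' (sym (CycNext-functional πk→p πk→πk')))

  punchIn-straddle⁻ : ∀ {n} (p : Fin (suc n)) {k k' : Fin n} →
                      CycNext G (punchIn p k) p → CycNext G p (punchIn p k') → CycNext G k k'
  punchIn-straddle⁻ p {k} πk→p p→πk' with CycNext-serial k
  ... | k'' , k→k'' with punchIn-CycNext⁺ p k→k''
  ... | inj₁ πk→πk'' = ⊥-elim (punchInᵢ≢i p k'' (CycNext-functional πk→πk'' πk→p))
  ... | inj₂ (_ , p→πk'') =
    subst (CycNext G k) (punchIn-injective p _ _ (CycNext-functional p→πk'' p→πk')) k→k''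

  chord-shortens : ∀ {m} (s t : Fin (suc m)) → s F.< t → ¬ Consec G s t →
                   ∃[ d ] (d + toℕ s ≡ toℕ t × 2 ≤ d × d < m)
  chord-shortens {m} s t s<t ¬s~t = d , d+s≡t , 2≤ d d+s≡t , <m (toℕ s) refl d+s≡t
    where
    d : ℕ
    d = toℕ t ∸ toℕ s
    d+s≡t : d + toℕ s ≡ toℕ t
    d+s≡t = m∸n+n≡m (<⇒≤ s<t)
    2≤ : ∀ d → d + toℕ s ≡ toℕ t → 2 ≤ d
    2≤ 0 s≡t = ⊥-elim (<-irrefl s≡t s<t)
    2≤ 1 s+1≡t = ⊥-elim (¬s~t (inj₁ (inj₁ s+1≡t)))
    2≤ (suc (suc _)) _ = s≤s (s≤s z≤n)
    <m : ∀ σ → σ ≡ toℕ s → d + σ ≡ toℕ t → d < m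
    <m 0 0≡s d+0≡t = subst (_< m) (trans (sym d+0≡t) (+-identityʳ d)) t<m
      where
      t<m : toℕ t < m
      t<m = ≤∧≢⇒< (toℕ≤pred[n] t) (λ t≡m → ¬s~t (inj₂ (inj₂ (cong suc t≡m , sym 0≡s))))
    <m (suc σ) _ d+σ≡t = <-≤-trans (m<m+n d (s≤s z≤n)) (subst (_≤ m) (sym d+σ≡t) (toℕ≤pred[n] t))

  -- No wrap-around: a < b < c, so abc is directly a Tri.
  record Ear {ℓ} (O : Fin ℓ → V) : Set where
    field
      a b c : Fin ℓ
      a+1≡b : suc (toℕ a) ≡ toℕ b
      b+1≡c : suc (toℕ b) ≡ toℕ c
      a~c   : E (O a) (O c)

  module FindEar {r} (chordal : Chordal G r) {n} {O : Fin (suc n) → V}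
                 (O-inj : Injective _≡_ _≡_ O) (O-next : ∀ i j → CycNext G i j → E (O i) (O j))
                 (ℓ≤r : suc n ≤ r) where

    module Window {m} (i j : Fin (suc n)) (m+i≡j : m + toℕ i ≡ toℕ j) (i~j : E (O i) (O j)) where

      position : Fin (suc m) → Fin (suc n)
      position k = fromℕ< (≤-<-trans (≤-trans (+-monoˡ-≤ (toℕ i) (toℕ≤pred[n] k)) (≤-reflexive m+i≡j))
                                     (toℕ<n j))

      toℕ-position : ∀ k → toℕ (position k) ≡ toℕ k + toℕ i
      toℕ-position k = toℕ-fromℕ< _

      window-isCycle : 2 ≤ m → IsCycle G (suc m) (O ∘ position)
      window-isCycle 2≤m = s≤s 2≤m , position-injective ∘ O-inj , next
        where
        position-injective : ∀ {k k'} → position k ≡ position k' → k ≡ k'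
        position-injective {k} {k'} e = toℕ-injective (+-cancelʳ-≡ (toℕ i) _ _
          (trans (sym (toℕ-position k)) (trans (cong toℕ e) (toℕ-position k'))))
        next : ∀ k k' → CycNext G k k' → E (O (position k)) (O (position k'))
        next k k' (inj₁ e) = O-next _ _ (inj₁ (trans (cong suc (toℕ-position k))
                                                 (trans (cong (_+ toℕ i) e) (sym (toℕ-position k')))))
        next k k' (inj₂ (e , e')) = subst₂ (λ p q → E (O p) (O q)) (sym last) (sym first) (E-sym i~j)
          where
          last : position k ≡ j
          last = toℕ-injective (trans (toℕ-position k) (trans (cong (_+ toℕ i) (suc-injective e)) m+i≡j))
          first : position k' ≡ i
          first = toℕ-injective (trans (toℕ-position k') (cong (_+ toℕ i) e'))

    earBetween : ∀ m → Acc _<_ m → (i j : Fin (suc n)) → m + toℕ i ≡ toℕ j → 2 ≤ m →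
                 E (O i) (O j) → Ear O
    earBetween 1 _ _ _ _ (s≤s ()) _
    earBetween 2 _ i j 2+i≡j _ i~j = record
      { a = i ; b = fromℕ< i+1<ℓ ; c = j
      ; a+1≡b = sym (toℕ-fromℕ< i+1<ℓ)
      ; b+1≡c = trans (cong suc (toℕ-fromℕ< i+1<ℓ)) 2+i≡j
      ; a~c = i~j }
      where
      i+1<ℓ : suc (toℕ i) < suc n
      i+1<ℓ = <-trans (n<1+n _) (subst (_< suc n) (sym 2+i≡j) (toℕ<n j))
    earBetween m@(suc (suc (suc _))) (acc shorter) i j m+i≡j _ i~j =
      descend (chordal (suc m) (O ∘ position) (window-isCycle (s≤s (s≤s z≤n)))
                       (s≤s (s≤s (s≤s (s≤s z≤n)))) (≤-trans (s≤s m≤n) ℓ≤r))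
      where
      open Window i j m+i≡j i~j

      m≤n : m ≤ n
      m≤n = ≤-trans (m≤m+n m (toℕ i)) (≤-trans (≤-reflexive m+i≡j) (toℕ≤pred[n] j))

      descendAlong : ∀ s t → s F.< t → E (O (position s)) (O (position t)) → ¬ Consec G s t → Ear O
      descendAlong s t s<t s~t ¬s~t with chord-shortens s t s<t ¬s~t
      ... | d , d+s≡t , 2≤d , d<m = earBetween d (shorter d<m) (position s) (position t) gap 2≤d s~t
        where
        open ≡-Reasoning
        gap : d + toℕ (position s) ≡ toℕ (position t)
        gap = begin
          d + toℕ (position s)   ≡⟨ cong (d +_) (toℕ-position s) ⟩
          d + (toℕ s + toℕ i)    ≡⟨ sym (+-assoc d (toℕ s) (toℕ i)) ⟩
          (d + toℕ s) + toℕ i    ≡⟨ cong (_+ toℕ i) d+s≡t ⟩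
          toℕ t + toℕ i          ≡⟨ sym (toℕ-position t) ⟩
          toℕ (position t)       ∎

      descend : HasChord G (suc m) (O ∘ position) → Ear O
      descend (s , t , s~t , ¬s~t , s≢t) with F.<-cmp s t
      ... | tri< s<t _ _ = descendAlong s t s<t s~t ¬s~t
      ... | tri≈ _ s≡t _ = ⊥-elim (s≢t s≡t)
      ... | tri> _ _ t<s = descendAlong t s t<s (E-sym s~t) (¬s~t ∘ Sum.swap)

    findEar : 3 ≤ n → Ear O
    findEar 3≤n = earBetween n (<-wellFounded n) 0F (fromℕ n)
      (trans (+-identityʳ n) (sym (toℕ-fromℕ n))) (≤-trans (n≤1+n 2) 3≤n)
      (E-sym (O-next (fromℕ n) 0F (inj₂ (cong suc (toℕ-fromℕ n) , refl))))

  TriangleDecomposition : ∀ {ℓ} → (Fin ℓ → V) → Set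
  TriangleDecomposition {ℓ} O = Σ (List (Tri G O)) λ ts → (length ts ≡ ℓ ∸ 2 × Unique (map (triIdx G) ts)
    × SameEdges G (ΔList G (map (triEdges G) ts)) (cycleEdges G O))

  triangle-decomposition : {O : Fin 3 → V} → (∀ i j → CycNext G i j → E (O i) (O j)) →
                           TriangleDecomposition O
  triangle-decomposition {O} O-next =
    T ∷ [] , refl , [] ∷ [] , λ x y → ⇔.trans (Δ-identityʳ {triEdges G T} x y) (mk⇔ to from)
    where
    T : Tri G O
    T = tri 0F 1F 2F (s≤s z≤n) (s≤s (s≤s z≤n))
          (O-next 0F 1F (inj₁ refl)) (E-sym (O-next 2F 0F (inj₂ (refl , refl)))) (O-next 1F 2F (inj₁ refl))
    to : ∀ {x y} → triEdges G T x y → cycleEdges G O x y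
    to (inj₁ u) = 0F , 1F , inj₁ refl , u
    to (inj₂ (inj₁ u)) = 2F , 0F , inj₂ (refl , refl) , UEq-swap u
    to (inj₂ (inj₂ u)) = 1F , 2F , inj₁ refl , u
    from : ∀ {x y} → cycleEdges G O x y → triEdges G T x y
    from {x} {y} (0F , j , 0→j , u) =
      inj₁ (subst (λ j → UEq G x y (O 0F) (O j)) (CycNext-functional 0→j (inj₁ refl)) u)
    from {x} {y} (1F , j , 1→j , u) =
      inj₂ (inj₂ (subst (λ j → UEq G x y (O 1F) (O j)) (CycNext-functional 1→j (inj₁ refl)) u))
    from {x} {y} (2F , j , 2→j , u) =
      inj₂ (inj₁ (UEq-swap (subst (λ j → UEq G x y (O 2F) (O j))
                                  (CycNext-functional 2→j (inj₂ (refl , refl))) u)))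

  module RemoveEar {n} {O : Fin (suc n) → V} (3≤n : 3 ≤ n)
                   (O-inj : Injective _≡_ _≡_ O) (O-next : ∀ i j → CycNext G i j → E (O i) (O j))
                   (ear : Ear O) where
    open Ear ear

    shortcut : Fin n → V
    shortcut = O ∘ punchIn b

    a→b : CycNext G a b
    a→b = inj₁ a+1≡b

    b→c : CycNext G b c
    b→c = inj₁ b+1≡c

    b≢a : b ≢ a
    b≢a b≡a = 1+n≢n (trans a+1≡b (cong toℕ b≡a))

    b≢c : b ≢ c
    b≢c b≡c = 1+n≢n (trans b+1≡c (cong toℕ (sym b≡c)))

    a↛c : ¬ CycNext G a c
    a↛c a→c = b≢c (CycNext-functional a→b a→c)

    c↛a : ¬ CycNext G c a
    c↛a (inj₁ c+1≡a) = m≢1+n+m (toℕ a) (trans (sym c+1≡a) (cong suc c≡a+2))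
      where
      c≡a+2 : toℕ c ≡ suc (suc (toℕ a))
      c≡a+2 = trans (sym b+1≡c) (cong suc (sym a+1≡b))
    c↛a (inj₂ (c+1≡ℓ , a≡0)) = <-irrefl (sym n≡2) 3≤n
      where
      n≡2 : n ≡ 2
      n≡2 = trans (sym (suc-injective c+1≡ℓ))
                  (trans (sym b+1≡c) (cong suc (trans (sym a+1≡b) (cong suc a≡0))))

    shortcut-isCycle : IsCycle G n shortcut
    shortcut-isCycle = 3≤n , (λ e → punchIn-injective b _ _ (O-inj e)) , next
      where
      next : ∀ k k' → CycNext G k k' → E (shortcut k) (shortcut k')
      next k k' k→k' with punchIn-CycNext⁺ b k→k'
      ... | inj₁ πk→πk' = O-next _ _ πk→πk'
      ... | inj₂ (πk→b , b→πk') = subst₂ (λ p q → E (O p) (O q))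
              (sym (CycNext-injective πk→b a→b)) (sym (CycNext-functional b→πk' b→c)) a~c

    earTri : Tri G O
    earTri = tri a b c (≤-reflexive a+1≡b) (≤-reflexive b+1≡c) (O-next a b a→b) a~c (O-next b c b→c)

    liftTri : Tri G shortcut → Tri G O
    liftTri t = tri (punchIn b i) (punchIn b j) (punchIn b k)
                    (punchIn-mono-< b i<j) (punchIn-mono-< b j<k) eij eik ejk
      where open Tri t

    punchIn³ : Fin n × Fin n × Fin n → Fin (suc n) × Fin (suc n) × Fin (suc n)
    punchIn³ (i , j , k) = punchIn b i , punchIn b j , punchIn b k

    punchIn³-injective : ∀ {x y} → punchIn³ x ≡ punchIn³ y → x ≡ y
    punchIn³-injective {_ , _ , _} {_ , _ , _} e =
      cong₂ _,_ (punchIn-injective b _ _ (cong proj₁ e))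
        (cong₂ _,_ (punchIn-injective b _ _ (cong (proj₁ ∘ proj₂) e))
                   (punchIn-injective b _ _ (cong (proj₂ ∘ proj₂) e)))

    earTri∉liftTri : ∀ t → triIdx G earTri ≢ triIdx G (liftTri t)
    earTri∉liftTri t e = punchInᵢ≢i b (Tri.j t) (sym (cong (proj₁ ∘ proj₂) e))

    UEq-index : ∀ {x y i j i' j'} → UEq G x y (O i) (O j) → UEq G x y (O i') (O j') →
                (i ≡ i' × j ≡ j') ⊎ (i ≡ j' × j ≡ i')
    UEq-index u u' = Sum.map (Product.map O-inj O-inj) (Product.map O-inj O-inj) (UEq-unique u u')

    b-edge∉shortcut : ∀ {x y z} → UEq G x y (O b) z → ¬ cycleEdges G shortcut x y
    b-edge∉shortcut u (k , k' , _ , u') with UEq-unique u u'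
    ... | inj₁ (Ob≡Oπk , _) = punchInᵢ≢i b k (sym (O-inj Ob≡Oπk))
    ... | inj₂ (Ob≡Oπk' , _) = punchInᵢ≢i b k' (sym (O-inj Ob≡Oπk'))

    ac∈shortcut : ∀ {x y} → UEq G x y (O a) (O c) → cycleEdges G shortcut x y
    ac∈shortcut {x} {y} ac = punchOut b≢a , punchOut b≢c , straddle ,
                             subst₂ (λ p q → UEq G x y (O p) (O q)) (sym πka≡a) (sym πkc≡c) ac
      where
      πka≡a = punchIn-punchOut b≢a
      πkc≡c = punchIn-punchOut b≢c
      straddle = punchIn-straddle⁻ b (subst (λ i → CycNext G i b) (sym πka≡a) a→b)
                                     (subst (CycNext G b) (sym πkc≡c) b→c)

    earTri-Δ-shortcut : SameEdges G (_Δ_ G (triEdges G earTri) (cycleEdges G shortcut)) (cycleEdges G O)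
    earTri-Δ-shortcut x y = mk⇔ bwd fwd
      where
      UEqAt : Fin (suc n) → Fin (suc n) → Set
      UEqAt i j = UEq G x y (O i) (O j)

      bwd : _Δ_ G (triEdges G earTri) (cycleEdges G shortcut) x y → cycleEdges G O x y
      bwd (inj₁ (inj₁ ab , _)) = a , b , a→b , ab
      bwd (inj₁ (inj₂ (inj₂ bc) , _)) = b , c , b→c , bc
      bwd (inj₁ (inj₂ (inj₁ ac) , ∉shortcut)) = ⊥-elim (∉shortcut (ac∈shortcut ac))
      bwd (inj₂ (∉earTri , k , k' , k→k' , u)) with punchIn-CycNext⁺ b k→k'
      ... | inj₁ πk→πk' = punchIn b k , punchIn b k' , πk→πk' , u
      ... | inj₂ (πk→b , b→πk') = ⊥-elim (∉earTri (inj₂ (inj₁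
              (subst₂ UEqAt (CycNext-injective πk→b a→b) (CycNext-functional b→πk' b→c) u))))

      fwd : cycleEdges G O x y → _Δ_ G (triEdges G earTri) (cycleEdges G shortcut) x y
      fwd (i , j , i→j , u) with i F.≟ b | j F.≟ b
      ... | yes refl | _ =
        inj₁ (inj₂ (inj₂ (subst (UEqAt b) (CycNext-functional i→j b→c) u)) , b-edge∉shortcut u)
      ... | no _ | yes refl =
        inj₁ (inj₁ (subst (λ i → UEqAt i b) (CycNext-injective i→j a→b) u) ,
              b-edge∉shortcut (UEq-swap u))
      ... | no i≢b | no j≢b = inj₂ (∉earTri , k , k' ,
              punchIn-CycNext⁻ b (subst₂ (CycNext G) (sym πk≡i) (sym πk'≡j) i→j) ,
              subst₂ UEqAt (sym πk≡i) (sym πk'≡j) u)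
        where
        k = punchOut (i≢b ∘ sym)
        k' = punchOut (j≢b ∘ sym)
        πk≡i = punchIn-punchOut (i≢b ∘ sym)
        πk'≡j = punchIn-punchOut (j≢b ∘ sym)
        b∉ij : ∀ {z} → UEqAt b z → ⊥
        b∉ij b-edge with UEq-index b-edge u
        ... | inj₁ (b≡i , _) = i≢b (sym b≡i)
        ... | inj₂ (b≡j , _) = j≢b (sym b≡j)
        ∉earTri : ¬ triEdges G earTri x y
        ∉earTri (inj₁ ab) = b∉ij (UEq-swap ab)
        ∉earTri (inj₂ (inj₂ bc)) = b∉ij bc
        ∉earTri (inj₂ (inj₁ ac)) with UEq-index ac u
        ... | inj₁ (a≡i , c≡j) = a↛c (subst₂ (CycNext G) (sym a≡i) (sym c≡j) i→j)
        ... | inj₂ (a≡j , c≡i) = c↛a (subst₂ (CycNext G) (sym c≡i) (sym a≡j) i→j)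

    extend : TriangleDecomposition shortcut → TriangleDecomposition O
    extend (ts , |ts| , unique , edges) =
      earTri ∷ map liftTri ts , |earTri∷ts| ,
      All.map⁺ (All.map⁺ (All.universal earTri∉liftTri ts)) ∷ lifted-unique , edges'
      where
      |earTri∷ts| : suc (length (map liftTri ts)) ≡ suc n ∸ 2
      |earTri∷ts| = trans (cong suc (trans (length-map liftTri ts) |ts|))
                          (sym (+-∸-assoc 1 (≤-trans (n≤1+n 2) 3≤n)))

      triIdx-liftTri : map (triIdx G) (map liftTri ts) ≡ map punchIn³ (map (triIdx G) ts)
      triIdx-liftTri = trans (sym (map-∘ ts)) (map-∘ ts)

      lifted-unique : Unique (map (triIdx G) (map liftTri ts))
      lifted-unique = subst Unique (sym triIdx-liftTri) (Unique.map⁺ punchIn³-injective unique)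

      triEdges-liftTri : map (triEdges G) ts ≡ map (triEdges G) (map liftTri ts)
      triEdges-liftTri = map-∘ ts

      edges' : SameEdges G (ΔList G (map (triEdges G) (earTri ∷ map liftTri ts))) (cycleEdges G O)
      edges' x y = ⇔.trans
        (Δ-congʳ {R = triEdges G earTri}
          (subst (λ Ts → SameEdges G (ΔList G Ts) (cycleEdges G shortcut)) triEdges-liftTri edges) x y)
        (earTri-Δ-shortcut x y)

  triangulate : ∀ {r} → Chordal G r → ∀ ℓ (O : Fin ℓ → V) → IsCycle G ℓ O → ℓ ≤ r →
                TriangleDecomposition O
  triangulate _ 0 _ (() , _) _
  triangulate _ 1 _ (s≤s () , _) _
  triangulate _ 2 _ (s≤s (s≤s ()) , _) _
  triangulate _ 3 O (_ , _ , O-next) _ = triangle-decomposition O-next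
  triangulate chordal (suc n@(suc (suc (suc _)))) O (_ , O-inj , O-next) ℓ≤r =
    extend (triangulate chordal n shortcut shortcut-isCycle (≤-trans (n≤1+n n) ℓ≤r))
    where
    3≤n : 3 ≤ n
    3≤n = s≤s (s≤s (s≤s z≤n))
    open RemoveEar 3≤n O-inj O-next (FindEar.findEar chordal O-inj O-next ℓ≤r 3≤n)

lemma2p7 : (r : ℕ) → 3 ≤ r → (G : Graph) → Chordal G r →
    (ℓ : ℕ) (O : Fin ℓ → Graph.V G) → IsCycle G ℓ O → ℓ ≤ r →
    Σ (List (Tri G O)) λ ts → (length ts ≡ ℓ ∸ 2 × Unique (map (triIdx G) ts)
      × SameEdges G (ΔList G (map (triEdges G) ts)) (cycleEdges G O))
lemma2p7 r _ G chordal ℓ O cycle ℓ≤r = triangulate G chordal ℓ O cycle ℓ≤r
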